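{- Consider the $p$-processor cup game on $n \ge p+1$ cups with the emptier following the greedy algorithm, and let $S_{t-1}, S_t$ be the states after consecutive steps $t-1$ and $t$. If $S_t(1) > S_{t-1}(1)$, then $S_t(1), S_t(2), \ldots, S_t(p+1) \ge S_t(1) - 1$.
   Context: The $p$-processor cup game on $n$ cups: there are $n$ cups, each holding a nonnegative real amount of water (its fill). In each step, the filler first distributes up to $p$ units of water among the cups, placing at most $1$ unit into any single cup; then the emptier selects $p$ cups and removes up to $1$ unit of water from each of them. The greedy algorithm for the emptier: in each step, after the filler has placed water, remove $1$ unit of water from each of the $p$ fullest cups (removing all of a cup's water if it contains less than $1$ unit); ties broken arbitrarily. $S_t$ denotes the state after step $t$, and for a state $S$, $S(i)$ denotes the fill of the $i$-th fullest cup (the rank-$i$ cup) in $S$. The condition $n \ge p+1$ just ensures $S_t(p+1)$ is defined.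
   Formalization: The cup fills and the amounts of water the filler places are rational rather than real. -}

module Defs where

open import Data.Nat using (ℕ; zero; suc; _∸_)
open import Data.Fin using (Fin)
open import Data.Fin.Subset using (Subset; _∈_; _∉_; ∣_∣)
open import Data.List using (List; []; _∷_; tabulate; reverse; foldr)
open import Data.Rational using (ℚ; 0ℚ; 1ℚ; _+_; _-_; _≤_; _⊔_)
open import Data.Rational.Properties using (≤-decTotalOrder)
open import Data.Product using (_×_; Σ)
open import Relation.Binary.PropositionalEquality using (_≡_)
import Data.List.Sort
import Data.Rational as ℚ
import Data.Integer as ℤ

open Data.List.Sort ≤-decTotalOrder using (sort)

State : ℕ → Set
State n = Fin n → ℚ

Σℚ : ∀ {n} → (Fin n → ℚ) → ℚ
Σℚ f = foldr _+_ 0ℚ (tabulate f)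

sortedDesc : ∀ {n} → State n → List ℚ
sortedDesc S = reverse (sort (tabulate S))

-- 0-indexed access with default 0 (default never used for valid ranks).
nth : List ℚ → ℕ → ℚ
nth []       _       = 0ℚ
nth (x ∷ xs) zero    = x
nth (x ∷ xs) (suc k) = nth xs k

-- S(i): the fill of the rank-i (i-th fullest) cup, ranks starting at 1.
rank : ∀ {n} → State n → ℕ → ℚ
rank S i = nth (sortedDesc S) (i ∸ 1)

ValidFill : (n p : ℕ) → (Fin n → ℚ) → Set
ValidFill n p a =
  ((i : Fin n) → (0ℚ ≤ a i) × (a i ≤ 1ℚ)) × (Σℚ a ≤ (ℤ.+ p ℚ./ 1))

afterFill : ∀ {n} → State n → (Fin n → ℚ) → State n
afterFill S a i = S i + a i

-- E is a valid greedy choice in (post-fill) state I: exactly p cups, and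
-- they are p fullest cups (ties broken arbitrarily).
GreedyChoice : (n p : ℕ) → State n → Subset n → Set
GreedyChoice n p I E =
  (∣ E ∣ ≡ p) × ((i j : Fin n) → i ∈ E → j ∉ E → I j ≤ I i)

open import Data.Bool using (if_then_else_)
import Data.Vec as V

afterEmpty : ∀ {n} → State n → Subset n → State n
afterEmpty I E i = if V.lookup E i then 0ℚ ⊔ (I i - 1ℚ) else I i

GreedyStep : (n p : ℕ) → State n → State n → Set
GreedyStep n p S S' =
  Σ (Fin n → ℚ) λ a → Σ (Subset n) λ E →
    ValidFill n p a × GreedyChoice n p (afterFill S a) E
      × ((i : Fin n) → S' i ≡ afterEmpty (afterFill S a) E i)

Nonneg : ∀ {n} → State n → Set
Nonneg S = ∀ i → 0ℚ ≤ S i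

{-# OPTIONS --safe #-}
-- Let x be a fullest cup after the step. If the emptier took water from x, then
-- S₁ x = max(0, S₀ x + a x - 1) ≤ S₀ x ≤ S₀(1), so the maximum did not rise.
-- Otherwise the p emptied cups were at least as full as x before emptying, so
-- they and x are p + 1 cups holding at least S₁(1) - 1 afterwards. Finally, if
-- k cups hold at least c then so do the ranks 1, …, k: a descending list whose
-- entry at index k is below c has at most k entries ≥ c.
module Submission where

open import Defs
open import Data.Nat using (ℕ; suc; _≤_)
open import Data.Rational using (ℚ; 1ℚ; _-_; _<_) renaming (_≤_ to _≤ℚ_)

open import Data.Bool using (true; false)
open import Data.Fin using (zero; suc)
open import Data.Fin.Subset using (Subset; _∈_; _∉_; ∣_∣; _∪_; ⁅_⁆; inside; outside)
open import Data.Fin.Subset.Properties using (_∈?_; ∣⁅x⁆∣≡1; x∈⁅x⁆; x∈⁅y⁆⇒x≡y; p⊆p∪q; x∈p∪q⁺; x∈p∪q⁻; p⊂q⇒∣p∣<∣q∣)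
open import Data.List using (List; []; _∷_; length; filter; tabulate; reverse)
open import Data.List.Properties using (unfold-reverse; filter-none; filter-accept; filter-reject)
open import Data.List.Membership.Propositional.Properties using (∈-tabulate⁺; ∈-tabulate⁻)
open import Data.List.Relation.Binary.Permutation.Propositional using (_↭_; ↭-sym; ↭-trans)
open import Data.List.Relation.Binary.Permutation.Propositional.Properties using (↭-length; ↭-reverse; filter-↭; All-resp-↭; ∈-resp-↭)
open import Data.List.Relation.Unary.All as All using (All; []; _∷_)
open import Data.List.Relation.Unary.AllPairs using (AllPairs; []; _∷_)
open import Data.List.Relation.Unary.AllPairs.Properties using (++⁺)
open import Data.List.Relation.Unary.Any using (here)
open import Data.List.Relation.Unary.Linked.Properties using (Linked⇒AllPairs)
open import Data.Nat using (zero; z≤n; s≤s)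
import Data.Nat.Properties as ℕ
open import Data.Product using (_,_; proj₂; ∃-syntax)
open import Data.Rational using (0ℚ; _+_; -_; _⊔_; _≥_)
open import Data.Rational.Properties as ℚ using (≤-decTotalOrder; _≤?_)
open import Data.Sum using (inj₁; inj₂)
open import Data.Vec as Vec using ([]; _∷_)
import Data.Vec.Properties as Vec
open import Function using (_∘_; flip)
open import Relation.Binary.PropositionalEquality using (_≡_; refl; sym; trans; cong; subst)
open import Relation.Nullary using (¬_; yes; no; contradiction)

open import Data.List.Sort ≤-decTotalOrder using (sort-↭; sort-↗)

AllPairs-reverse⁺ : ∀ {A : Set} {R : A → A → Set} {xs : List A} →
                    AllPairs R xs → AllPairs (flip R) (reverse xs)
AllPairs-reverse⁺ [] = []
AllPairs-reverse⁺ {xs = x ∷ xs} (Rx ∷ Rxs) rewrite unfold-reverse x xs =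
  ++⁺ (AllPairs-reverse⁺ Rxs) ([] ∷ []) (All.map (_∷ []) (All-resp-↭ (↭-sym (↭-reverse xs)) Rx))

<⇒≱ : ∀ {p q} → p < q → ¬ q ≤ℚ p
<⇒≱ p<q q≤p = ℚ.<-irrefl refl (ℚ.<-≤-trans p<q q≤p)

p-1≤p : ∀ p → p - 1ℚ ≤ℚ p
p-1≤p p = ℚ.≤-trans (ℚ.+-monoʳ-≤ p (ℚ.nonPositive⁻¹ (- 1ℚ))) (ℚ.≤-reflexive (ℚ.+-identityʳ p))

p+q-1≤p : ∀ p {q} → q ≤ℚ 1ℚ → (p + q) - 1ℚ ≤ℚ p
p+q-1≤p p {q} q≤1 = begin
  (p + q) - 1ℚ     ≤⟨ ℚ.+-monoˡ-≤ (- 1ℚ) (ℚ.+-monoʳ-≤ p q≤1) ⟩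
  (p + 1ℚ) - 1ℚ    ≡⟨ ℚ.+-assoc p 1ℚ (- 1ℚ) ⟩
  p + (1ℚ - 1ℚ)    ≡⟨ cong (p +_) (ℚ.+-inverseʳ 1ℚ) ⟩
  p + 0ℚ           ≡⟨ ℚ.+-identityʳ p ⟩
  p                ∎
  where open ℚ.≤-Reasoning

∣p∣<∣p∪⁅x⁆∣ : ∀ {n} {p : Subset n} {x} → x ∉ p → suc ∣ p ∣ ≤ ∣ p ∪ ⁅ x ⁆ ∣
∣p∣<∣p∪⁅x⁆∣ {x = x} x∉p = p⊂q⇒∣p∣<∣q∣ (p⊆p∪q ⁅ x ⁆ , x , x∈p∪q⁺ (inj₂ (x∈⁅x⁆ x)) , x∉p)

Descending : List ℚ → Set
Descending = AllPairs _≥_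

sortedDesc-↭ : ∀ {n} (S : State n) → sortedDesc S ↭ tabulate S
sortedDesc-↭ S = ↭-trans (↭-reverse _) (sort-↭ _)

sortedDesc-descending : ∀ {n} (S : State n) → Descending (sortedDesc S)
sortedDesc-descending S = AllPairs-reverse⁺ (Linked⇒AllPairs ℚ.≤-trans (sort-↗ _))

count≥ : ℚ → List ℚ → ℕ
count≥ c xs = length (filter (c ≤?_) xs)

count≥-↭ : ∀ c {xs ys} → xs ↭ ys → count≥ c xs ≡ count≥ c ys
count≥-↭ c xs↭ys = ↭-length (filter-↭ (c ≤?_) xs↭ys)

count≥-accept : ∀ {c x} xs → c ≤ℚ x → count≥ c (x ∷ xs) ≡ suc (count≥ c xs)
count≥-accept _ c≤x = cong length (filter-accept (_ ≤?_) c≤x)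

count≥-reject : ∀ {c x} xs → ¬ c ≤ℚ x → count≥ c (x ∷ xs) ≡ count≥ c xs
count≥-reject _ c≰x = cong length (filter-reject (_ ≤?_) c≰x)

count≥-descending : ∀ c {xs} → Descending xs → ∀ k → nth xs k < c → count≥ c xs ≤ k
count≥-descending c [] k _ = z≤n
count≥-descending c {x ∷ xs} (x≥xs ∷ _) k _ with c ≤? x
count≥-descending c {x ∷ xs} (x≥xs ∷ _) k _ | no c≰x =
  subst (_≤ k) (sym (cong length (filter-none (c ≤?_) (c≰x ∷ All.map (λ y≤x c≤y → c≰x (ℚ.≤-trans c≤y y≤x)) x≥xs)))) z≤n
count≥-descending c {x ∷ xs} _ zero x<c | yes c≤x = contradiction c≤x (<⇒≱ x<c)
count≥-descending c {x ∷ xs} (_ ∷ desc) (suc k) xₖ<c | yes c≤x =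
  subst (_≤ suc k) (sym (count≥-accept xs c≤x)) (s≤s (count≥-descending c desc k xₖ<c))

∣F∣≤count≥ : ∀ c {n} (S : State n) (F : Subset n) → (∀ j → j ∈ F → c ≤ℚ S j) →
             ∣ F ∣ ≤ count≥ c (tabulate S)
∣F∣≤count≥ c S [] _ = z≤n
∣F∣≤count≥ c S (s ∷ F) F≥c
  with ih ← ∣F∣≤count≥ c (S ∘ suc) F (λ j → F≥c (suc j) ∘ Vec.there)
  with c ≤? S zero | s
... | yes c≤S₀ | inside  = subst (suc ∣ F ∣ ≤_) (sym (count≥-accept _ c≤S₀)) (s≤s ih)
... | yes c≤S₀ | outside = subst (∣ F ∣ ≤_) (sym (count≥-accept _ c≤S₀)) (ℕ.m≤n⇒m≤1+n ih)
... | no  c≰S₀ | inside  = contradiction (F≥c zero Vec.here) c≰S₀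
... | no  c≰S₀ | outside = subst (∣ F ∣ ≤_) (sym (count≥-reject _ c≰S₀)) ih

≤-rank : ∀ {n} (S : State n) (F : Subset n) {c} → (∀ j → j ∈ F → c ≤ℚ S j) →
         ∀ k → suc k ≤ ∣ F ∣ → c ≤ℚ rank S (suc k)
≤-rank S F {c} F≥c k k<∣F∣ = ℚ.≮⇒≥ λ rank<c → ℕ.<-irrefl refl (begin-strict
  count≥ c (sortedDesc S)  ≤⟨ count≥-descending c (sortedDesc-descending S) k rank<c ⟩
  k                        <⟨ k<∣F∣ ⟩
  ∣ F ∣                    ≤⟨ ∣F∣≤count≥ c S F F≥c ⟩
  count≥ c (tabulate S)    ≡⟨ count≥-↭ c (sortedDesc-↭ S) ⟨
  count≥ c (sortedDesc S)  ∎)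
  where open ℕ.≤-Reasoning

≤-rank₁ : ∀ {n} (S : State n) j → S j ≤ℚ rank S 1
≤-rank₁ S j = ≤-rank S ⁅ j ⁆ (λ i i∈⁅j⁆ → ℚ.≤-reflexive (cong S (sym (x∈⁅y⁆⇒x≡y j i∈⁅j⁆))))
                     0 (ℕ.≤-reflexive (sym (∣⁅x⁆∣≡1 j)))

rank₁-attained : ∀ {n} (S : State (suc n)) → ∃[ x ] rank S 1 ≡ S x
rank₁-attained S with sortedDesc S | sortedDesc-↭ S
... | []    | []↭S = contradiction (∈-resp-↭ (↭-sym []↭S) (∈-tabulate⁺ {f = S} zero)) λ ()
... | y ∷ _ | y∷↭S = ∈-tabulate⁻ (∈-resp-↭ y∷↭S (here refl))

afterEmpty-∈ : ∀ {n} (I : State n) {E j} → j ∈ E → afterEmpty I E j ≡ 0ℚ ⊔ (I j - 1ℚ)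
afterEmpty-∈ I j∈E rewrite Vec.[]=⇒lookup j∈E = refl

afterEmpty-∉ : ∀ {n} (I : State n) {E j} → j ∉ E → afterEmpty I E j ≡ I j
afterEmpty-∉ I {E} {j} j∉E with Vec.lookup E j in eq
... | true  = contradiction (Vec.lookup⇒[]= j E eq) j∉E
... | false = refl

emptied-≤-rank₁ : ∀ {n} {S : State n} a E {j} → Nonneg S → a j ≤ℚ 1ℚ → j ∈ E →
                  afterEmpty (afterFill S a) E j ≤ℚ rank S 1
emptied-≤-rank₁ {S = S} a E {j} S≥0 aⱼ≤1 j∈E = begin
  afterEmpty (afterFill S a) E j  ≡⟨ afterEmpty-∈ (afterFill S a) j∈E ⟩
  0ℚ ⊔ ((S j + a j) - 1ℚ)          ≤⟨ ℚ.⊔-lub (S≥0 j) (p+q-1≤p (S j) aⱼ≤1) ⟩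
  S j                              ≤⟨ ≤-rank₁ S j ⟩
  rank S 1                         ∎
  where open ℚ.≤-Reasoning

afterEmpty-fullest-≥ : ∀ {n} (I : State n) {E x} → (∀ i j → i ∈ E → j ∉ E → I j ≤ℚ I i) → x ∉ E →
           ∀ j → j ∈ E ∪ ⁅ x ⁆ → I x - 1ℚ ≤ℚ afterEmpty I E j
afterEmpty-fullest-≥ I {E} {x} fullest x∉E j j∈E∪⁅x⁆ with x∈p∪q⁻ E ⁅ x ⁆ j∈E∪⁅x⁆
... | inj₁ j∈E = begin
  I x - 1ℚ           ≤⟨ ℚ.+-monoˡ-≤ (- 1ℚ) (fullest j x j∈E x∉E) ⟩
  I j - 1ℚ           ≤⟨ ℚ.p≤q⊔p 0ℚ _ ⟩
  0ℚ ⊔ (I j - 1ℚ)    ≡⟨ afterEmpty-∈ I j∈E ⟨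
  afterEmpty I E j   ∎
  where open ℚ.≤-Reasoning
... | inj₂ j∈⁅x⁆ rewrite x∈⁅y⁆⇒x≡y x j∈⁅x⁆ | afterEmpty-∉ I x∉E = p-1≤p (I x)

lemma4p3 : (n p : ℕ) → suc p ≤ n → (S₀ S₁ : State n) → Nonneg S₀ → GreedyStep n p S₀ S₁ → rank S₀ 1 < rank S₁ 1 → (i : ℕ) → 1 ≤ i → i ≤ suc p → rank S₁ 1 - 1ℚ ≤ℚ rank S₁ i
lemma4p3 (suc n) p (s≤s _) S₀ S₁ S₀≥0 (a , E , (a∈[0,1] , _) , (∣E∣≡p , fullest) , S₁≡) rise (suc k) _ (s≤s k≤p)
  with x , top≡S₁x ← rank₁-attained S₁
  with x ∈? E
... | yes x∈E = contradiction no-rise (<⇒≱ rise)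
  where
  open ℚ.≤-Reasoning
  no-rise : rank S₁ 1 ≤ℚ rank S₀ 1
  no-rise = begin
    rank S₁ 1                       ≡⟨ trans top≡S₁x (S₁≡ x) ⟩
    afterEmpty (afterFill S₀ a) E x ≤⟨ emptied-≤-rank₁ a E S₀≥0 (proj₂ (a∈[0,1] x)) x∈E ⟩
    rank S₀ 1                       ∎
... | no x∉E = subst (_≤ℚ rank S₁ (suc k)) top-1≡ (≤-rank S₁ (E ∪ ⁅ x ⁆) above k (ℕ.≤-trans (s≤s k≤p) p<∣E∪⁅x⁆∣))
  where
  I : State (suc n)
  I = afterFill S₀ a
  top-1≡ : I x - 1ℚ ≡ rank S₁ 1 - 1ℚ
  top-1≡ = cong (_- 1ℚ) (sym (trans top≡S₁x (trans (S₁≡ x) (afterEmpty-∉ I x∉E))))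
  above : ∀ j → j ∈ E ∪ ⁅ x ⁆ → I x - 1ℚ ≤ℚ S₁ j
  above j j∈F = subst (I x - 1ℚ ≤ℚ_) (sym (S₁≡ j)) (afterEmpty-fullest-≥ I fullest x∉E j j∈F)
  p<∣E∪⁅x⁆∣ : suc p ≤ ∣ E ∪ ⁅ x ⁆ ∣
  p<∣E∪⁅x⁆∣ = subst (λ m → suc m ≤ ∣ E ∪ ⁅ x ⁆ ∣) ∣E∣≡p (∣p∣<∣p∪⁅x⁆∣ x∉E)
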